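{- Let $k\ge1$, $m\ge k+1$, and for $i=1,\dots,k$ let $\ell_i=\theta_ie_i-e_{i+1}\in\mathbb Z^m$ with $\theta_i\in\{1,-1\}$, and put $\theta=\prod_{i=1}^k\theta_i$. Then: (1) the $\ell_i$ are linearly independent and there are unique signs $\delta_i\in\{\pm1\}$ with $\sum_{i=1}^k\delta_i\ell_i=\theta e_1-e_{k+1}$; (2) these satisfy $\delta_k=1$, for $1<u\le k$ one has $\delta_{u-1}=\delta_u$ if $\theta_u=1$ and $\delta_{u-1}=-\delta_u$ if $\theta_u=-1$, and $\delta_1=\theta\theta_1$; (3) in the group $G$, regarding $\ell_i$ as the element $(\ell_i,\theta_i)$, the product $\ell_k\circ\ell_{k-1}\circ\cdots\circ\ell_1$ equals $(\theta e_1-e_{k+1},\theta)$.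
   Context: $e_1,\dots,e_m$ is the standard basis of $\mathbb Z^m$. $G$ is the group of pairs $(a,\sigma)$, $a\in\mathbb Z^m$, $\sigma\in\{\pm1\}$, with product $(b,\rho)\circ(a,\sigma)=(b+\rho a,\rho\sigma)$. An edge $\ell_i$ with $\theta_i=1$ is called black, with $\theta_i=-1$ red. -}

module Defs where

open import Data.Nat as ℕ using (ℕ; zero; suc; _≤_)
open import Data.Fin as Fin using (Fin; zero; suc; inject₁; inject≤; fromℕ)
open import Data.Integer as ℤ using (ℤ; _◃_; 0ℤ; 1ℤ)
open import Data.Sign as Sign using (Sign)
open import Data.Product using (_×_; _,_)
open import Relation.Binary.PropositionalEquality using (_≡_)
open import Relation.Nullary using (yes; no)

Vecℤ : ℕ → Set
Vecℤ m = Fin m → ℤ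

sgn : Sign → ℤ
sgn s = s ◃ 1

e : ∀ {m} → Fin m → Vecℤ m
e j i with j Fin.≟ i
... | yes _ = 1ℤ
... | no _ = 0ℤ

_⊕_ : ∀ {m} → Vecℤ m → Vecℤ m → Vecℤ m
(a ⊕ b) i = a i ℤ.+ b i

_⊖_ : ∀ {m} → Vecℤ m → Vecℤ m → Vecℤ m
(a ⊖ b) i = a i ℤ.- b i

_·_ : ∀ {m} → ℤ → Vecℤ m → Vecℤ m
(c · a) i = c ℤ.* a i

0v : ∀ {m} → Vecℤ m
0v _ = 0ℤ

_≗v_ : ∀ {m} → Vecℤ m → Vecℤ m → Set
a ≗v b = ∀ i → a i ≡ b i

lincomb : ∀ {k m} → (Fin k → ℤ) → (Fin k → Vecℤ m) → Vecℤ m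
lincomb {zero} c v = 0v
lincomb {suc k} c v = (c zero · v zero) ⊕ lincomb (λ i → c (suc i)) (λ i → v (suc i))

LinIndep : ∀ {k m} → (Fin k → Vecℤ m) → Set
LinIndep {k} v = ∀ (c : Fin k → ℤ) → lincomb c v ≗v 0v → ∀ i → c i ≡ 0ℤ

prodSign : ∀ {k} → (Fin k → Sign) → Sign
prodSign {zero} θ = Sign.+
prodSign {suc k} θ = θ zero Sign.* prodSign (λ i → θ (suc i))

-- embedding of the index set {1,…,k+1} (0-based: Fin (suc k)) into Fin m, given k+1 ≤ m
ι : ∀ {k m} → suc k ≤ m → Fin (suc k) → Fin m
ι p j = inject≤ j p

ℓ : ∀ {k m} → suc k ≤ m → (Fin k → Sign) → Fin k → Vecℤ m
ℓ p θ i = (sgn (θ i) · e (ι p (inject₁ i))) ⊖ e (ι p (suc i))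

target : ∀ {k m} → suc k ≤ m → (Fin k → Sign) → Vecℤ m
target {k} p θ = (sgn (prodSign θ) · e (ι p zero)) ⊖ e (ι p (fromℕ k))

G : ℕ → Set
G m = Vecℤ m × Sign

_∘G_ : ∀ {m} → G m → G m → G m
(b , ρ) ∘G (a , σ) = (b ⊕ (sgn ρ · a)) , (ρ Sign.* σ)

idG : ∀ {m} → G m
idG = 0v , Sign.+

_≈G_ : ∀ {m} → G m → G m → Set
(a , σ) ≈G (b , ρ) = (a ≗v b) × (σ ≡ ρ)

prodG : ∀ {k m} → (Fin k → G m) → G m
prodG {zero} g = idG
prodG {suc k} g = g (fromℕ k) ∘G prodG (λ i → g (inject₁ i))

{-# OPTIONS --safe #-}
-- Evaluating a combination of the ℓ_i at the first vertex isolates its first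
-- coefficient, so the ℓ_i are independent by peeling off one edge at a time.
-- With δ_i = θ_{i+1} ⋯ θ_k the sum Σ δ_i ℓ_i telescopes to θ e_1 − e_{k+1},
-- and independence makes these signs unique. The product in G telescopes in
-- the same way, starting from the last edge.
module Submission where

open import Defs
open import Data.Nat using (ℕ; zero; suc; _≤_)
open import Data.Fin as Fin using (Fin; zero; suc; inject₁; fromℕ)
open import Data.Fin.Properties using (suc-injective; 0≢1+n; inject≤-injective)
open import Data.Integer using (ℤ; 0ℤ; 1ℤ; _+_; _-_; _*_)
import Data.Integer.Properties as ℤ
open import Data.Integer.Tactic.RingSolver using (solve-∀)
open import Data.Sign as Sign using (Sign)
import Data.Sign.Properties as Sign
open import Algebra.Properties.CommutativeSemigroup Sign.*-commutativeSemigroup using (x∙yz≈y∙xz)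
open import Data.Product using (Σ; _×_; _,_; proj₁)
open import Function using (_∘_)
open import Function.Definitions using (Injective)
open import Relation.Binary.PropositionalEquality
  using (_≡_; _≢_; refl; sym; trans; cong; cong₂; module ≡-Reasoning)
open import Relation.Nullary using (yes; no; contradiction)

open ≡-Reasoning

e-diagonal : ∀ {m} (j : Fin m) → e j j ≡ 1ℤ
e-diagonal j with j Fin.≟ j
... | yes _   = refl
... | no j≢j = contradiction refl j≢j

e-offDiagonal : ∀ {m} {j x : Fin m} → j ≢ x → e j x ≡ 0ℤ
e-offDiagonal {j = j} {x} j≢x with j Fin.≟ x
... | yes j≡x = contradiction j≡x j≢x
... | no _    = refl

sgn-* : ∀ s t → sgn (s Sign.* t) ≡ sgn s * sgn t
sgn-* s t = ℤ.◃-distrib-* s t 1 1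

*sgn≡0⇒≡0 : ∀ c s → c * sgn s ≡ 0ℤ → c ≡ 0ℤ
*sgn≡0⇒≡0 c s eq =
  ℤ.*-cancelʳ-≡ c 0ℤ (sgn s) {{ℤ.◃-nonZero s 1}} (trans eq (sym (ℤ.*-zeroˡ (sgn s))))

lincomb-difference : ∀ {k m} (c d : Fin k → ℤ) (v : Fin k → Vecℤ m) →
  lincomb (λ i → c i - d i) v ≗v (lincomb c v ⊖ lincomb d v)
lincomb-difference {zero}  c d v x = refl
lincomb-difference {suc k} c d v x = begin
  (c zero - d zero) * v zero x + lincomb (λ i → c (suc i) - d (suc i)) (v ∘ suc) x
    ≡⟨ cong (((c zero - d zero) * v zero x) +_) (lincomb-difference (c ∘ suc) (d ∘ suc) (v ∘ suc) x) ⟩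
  (c zero - d zero) * v zero x + (lincomb (c ∘ suc) (v ∘ suc) x - lincomb (d ∘ suc) (v ∘ suc) x)
    ≡⟨ distrib (c zero) (d zero) (v zero x) _ _ ⟩
  lincomb c v x - lincomb d v x ∎
  where
  distrib : ∀ a b y r s → (a - b) * y + (r - s) ≡ (a * y + r) - (b * y + s)
  distrib = solve-∀

LinIndep⇒lincomb-injective : ∀ {k m} {v : Fin k → Vecℤ m} → LinIndep v →
  ∀ (c d : Fin k → ℤ) → lincomb c v ≗v lincomb d v → ∀ i → c i ≡ d i
LinIndep⇒lincomb-injective {v = v} indep c d eq i = ℤ.i-j≡0⇒i≡j (c i) (d i)
  (indep (λ i → c i - d i) (λ x → trans (lincomb-difference c d v x) (ℤ.i≡j⇒i-j≡0 (eq x))) i)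

-- The edges of the signed path through the vertices f 0, …, f k; ℓ p θ is ℓ′ (ι p) θ.
ℓ′ : ∀ {k m} → (Fin (suc k) → Fin m) → (Fin k → Sign) → Fin k → Vecℤ m
ℓ′ f θ i = (sgn (θ i) · e (f (inject₁ i))) ⊖ e (f (suc i))

target′ : ∀ {k m} → (Fin (suc k) → Fin m) → (Fin k → Sign) → Vecℤ m
target′ {k} f θ = (sgn (prodSign θ) · e (f zero)) ⊖ e (f (fromℕ k))

target′-zero : ∀ {m} (f : Fin 1 → Fin m) (θ : Fin 0 → Sign) → target′ f θ ≗v 0v
target′-zero f θ x =
  trans (cong (_- e (f zero) x) (ℤ.*-identityˡ (e (f zero) x))) (ℤ.+-inverseʳ (e (f zero) x))

lincomb-ℓ′-outside : ∀ {k m} (f : Fin (suc k) → Fin m) θ (c : Fin k → ℤ) x →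
  (∀ j → f j ≢ x) → lincomb c (ℓ′ f θ) x ≡ 0ℤ
lincomb-ℓ′-outside {zero}  f θ c x f≢x = refl
lincomb-ℓ′-outside {suc k} f θ c x f≢x = begin
  c zero * (sgn (θ zero) * e (f zero) x - e (f (suc zero)) x) + rest
    ≡⟨ cong₂ (λ a b → c zero * (sgn (θ zero) * a - b) + rest)
             (e-offDiagonal (f≢x zero)) (e-offDiagonal (f≢x (suc zero))) ⟩
  c zero * (sgn (θ zero) * 0ℤ - 0ℤ) + rest
    ≡⟨ cong (c zero * (sgn (θ zero) * 0ℤ - 0ℤ) +_)
            (lincomb-ℓ′-outside (f ∘ suc) (θ ∘ suc) (c ∘ suc) x (f≢x ∘ suc)) ⟩
  c zero * (sgn (θ zero) * 0ℤ - 0ℤ) + 0ℤ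
    ≡⟨ vanish (c zero) (sgn (θ zero)) ⟩
  0ℤ ∎
  where
  rest = lincomb (c ∘ suc) (ℓ′ (f ∘ suc) (θ ∘ suc)) x
  vanish : ∀ a t → a * (t * 0ℤ - 0ℤ) + 0ℤ ≡ 0ℤ
  vanish = solve-∀

-- Only the first edge meets the start vertex f 0.
lincomb-ℓ′-start : ∀ {k m} (f : Fin (suc (suc k)) → Fin m) θ (c : Fin (suc k) → ℤ) →
  Injective _≡_ _≡_ f → lincomb c (ℓ′ f θ) (f zero) ≡ c zero * sgn (θ zero)
lincomb-ℓ′-start f θ c f-inj = begin
  c zero * (sgn (θ zero) * e (f zero) (f zero) - e (f (suc zero)) (f zero)) + rest
    ≡⟨ cong₂ (λ a b → c zero * (sgn (θ zero) * a - b) + rest)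
             (e-diagonal (f zero)) (e-offDiagonal (f-suc≢f-zero zero)) ⟩
  c zero * (sgn (θ zero) * 1ℤ - 0ℤ) + rest
    ≡⟨ cong (c zero * (sgn (θ zero) * 1ℤ - 0ℤ) +_)
            (lincomb-ℓ′-outside (f ∘ suc) (θ ∘ suc) (c ∘ suc) (f zero) f-suc≢f-zero) ⟩
  c zero * (sgn (θ zero) * 1ℤ - 0ℤ) + 0ℤ
    ≡⟨ coefficient (c zero) (sgn (θ zero)) ⟩
  c zero * sgn (θ zero) ∎
  where
  rest = lincomb (c ∘ suc) (ℓ′ (f ∘ suc) (θ ∘ suc)) (f zero)
  f-suc≢f-zero : ∀ j → f (suc j) ≢ f zero
  f-suc≢f-zero j = 0≢1+n ∘ sym ∘ f-inj
  coefficient : ∀ a t → a * (t * 1ℤ - 0ℤ) + 0ℤ ≡ a * t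
  coefficient = solve-∀

lincomb-drop-head : ∀ {k m} (c : Fin (suc k) → ℤ) (v : Fin (suc k) → Vecℤ m) →
  c zero ≡ 0ℤ → lincomb c v ≗v lincomb (c ∘ suc) (v ∘ suc)
lincomb-drop-head c v c₀≡0 x = begin
  c zero * v zero x + rest  ≡⟨ cong (λ a → a * v zero x + rest) c₀≡0 ⟩
  0ℤ * v zero x + rest      ≡⟨ cong (_+ rest) (ℤ.*-zeroˡ (v zero x)) ⟩
  0ℤ + rest                 ≡⟨ ℤ.+-identityˡ rest ⟩
  rest                      ∎
  where rest = lincomb (c ∘ suc) (v ∘ suc) x

ℓ′-linIndep : ∀ {k m} (f : Fin (suc k) → Fin m) θ → Injective _≡_ _≡_ f → LinIndep (ℓ′ f θ)
ℓ′-linIndep {zero}  f θ f-inj c c≡0 ()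
ℓ′-linIndep {suc k} f θ f-inj c c≡0 = λ where
    zero    → c₀≡0
    (suc i) → ℓ′-linIndep (f ∘ suc) (θ ∘ suc) (suc-injective ∘ f-inj) (c ∘ suc)
                (λ x → trans (sym (lincomb-drop-head c (ℓ′ f θ) c₀≡0 x)) (c≡0 x)) i
  where
  c₀≡0 : c zero ≡ 0ℤ
  c₀≡0 = *sgn≡0⇒≡0 (c zero) (θ zero) (trans (sym (lincomb-ℓ′-start f θ c f-inj)) (c≡0 (f zero)))

prodSignAfter : ∀ {n} → (Fin n → Sign) → Fin n → Sign
prodSignAfter θ zero    = prodSign (θ ∘ suc)
prodSignAfter θ (suc i) = prodSignAfter (θ ∘ suc) i

prodSignAfter-last : ∀ {n} (θ : Fin (suc n) → Sign) → prodSignAfter θ (fromℕ n) ≡ Sign.+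
prodSignAfter-last {zero}  θ = refl
prodSignAfter-last {suc n} θ = prodSignAfter-last (θ ∘ suc)

prodSignAfter-inject₁ : ∀ {n} (θ : Fin (suc n) → Sign) (j : Fin n) →
  prodSignAfter θ (inject₁ j) ≡ θ (suc j) Sign.* prodSignAfter θ (suc j)
prodSignAfter-inject₁ θ zero    = refl
prodSignAfter-inject₁ θ (suc j) = prodSignAfter-inject₁ (θ ∘ suc) j

prodSignAfter-zero : ∀ {n} (θ : Fin (suc n) → Sign) →
  prodSignAfter θ zero ≡ prodSign θ Sign.* θ zero
prodSignAfter-zero θ = begin
  rest                               ≡⟨ Sign.*-identityʳ rest ⟨
  rest Sign.* Sign.+                 ≡⟨ cong (rest Sign.*_) (Sign.s*s≡+ (θ zero)) ⟨
  rest Sign.* (θ zero Sign.* θ zero) ≡⟨ Sign.*-assoc rest (θ zero) (θ zero) ⟨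
  rest Sign.* θ zero Sign.* θ zero   ≡⟨ cong (Sign._* θ zero) (Sign.*-comm rest (θ zero)) ⟩
  prodSign θ Sign.* θ zero           ∎
  where rest = prodSign (θ ∘ suc)

lincomb-prodSignAfter-ℓ′ : ∀ {k m} (f : Fin (suc k) → Fin m) θ →
  lincomb (sgn ∘ prodSignAfter θ) (ℓ′ f θ) ≗v target′ f θ
lincomb-prodSignAfter-ℓ′ {zero}  f θ x = sym (target′-zero f θ x)
lincomb-prodSignAfter-ℓ′ {suc k} f θ x = begin
  s * (t * a - b) + lincomb (sgn ∘ prodSignAfter (θ ∘ suc)) (ℓ′ (f ∘ suc) (θ ∘ suc)) x
    ≡⟨ cong (s * (t * a - b) +_) (lincomb-prodSignAfter-ℓ′ (f ∘ suc) (θ ∘ suc) x) ⟩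
  s * (t * a - b) + (s * b - c)
    ≡⟨ telescope s t a b c ⟩
  t * s * a - c
    ≡⟨ cong (λ r → r * a - c) (sgn-* (θ zero) (prodSign (θ ∘ suc))) ⟨
  target′ f θ x ∎
  where
  s = sgn (prodSign (θ ∘ suc))
  t = sgn (θ zero)
  a = e (f zero) x
  b = e (f (suc zero)) x
  c = e (f (fromℕ (suc k))) x
  telescope : ∀ s t a b c → s * (t * a - b) + (s * b - c) ≡ t * s * a - c
  telescope = solve-∀

prodSign-last : ∀ {k} (θ : Fin (suc k) → Sign) →
  prodSign θ ≡ θ (fromℕ k) Sign.* prodSign (θ ∘ inject₁)
prodSign-last {zero}  θ = refl
prodSign-last {suc k} θ = begin
  θ zero Sign.* prodSign (θ ∘ suc)
    ≡⟨ cong (θ zero Sign.*_) (prodSign-last (θ ∘ suc)) ⟩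
  θ zero Sign.* (θ (fromℕ (suc k)) Sign.* prodSign (θ ∘ suc ∘ inject₁))
    ≡⟨ x∙yz≈y∙xz (θ zero) (θ (fromℕ (suc k))) (prodSign (θ ∘ suc ∘ inject₁)) ⟩
  θ (fromℕ (suc k)) Sign.* prodSign (θ ∘ inject₁) ∎

prodG-ℓ′ : ∀ {k m} (f : Fin (suc k) → Fin m) θ →
  prodG (λ i → ℓ′ f θ i , θ i) ≈G (target′ f θ , prodSign θ)
prodG-ℓ′ {zero}  f θ = (λ x → sym (target′-zero f θ x)) , refl
prodG-ℓ′ {suc k} f θ with prodG-ℓ′ (f ∘ inject₁) (θ ∘ inject₁)
... | vec≈ , sign≡ = vector , trans (cong (θ (fromℕ k) Sign.*_) sign≡) (sym (prodSign-last θ))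
  where
  t = sgn (θ (fromℕ k))
  s = sgn (prodSign (θ ∘ inject₁))
  init = proj₁ (prodG (λ i → ℓ′ f θ (inject₁ i) , θ (inject₁ i)))
  vector : ∀ x → ℓ′ f θ (fromℕ k) x + t * init x ≡ target′ f θ x
  vector x = begin
    (t * b - c) + t * init x
      ≡⟨ cong (λ r → (t * b - c) + t * r) (vec≈ x) ⟩
    (t * b - c) + t * (s * a - b)
      ≡⟨ compose t s a b c ⟩
    t * s * a - c
      ≡⟨ cong (λ r → r * a - c) (sgn-* (θ (fromℕ k)) (prodSign (θ ∘ inject₁))) ⟨
    sgn (θ (fromℕ k) Sign.* prodSign (θ ∘ inject₁)) * a - c
      ≡⟨ cong (λ σ → sgn σ * a - c) (prodSign-last θ) ⟨
    target′ f θ x ∎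
    where
    a = e (f zero) x
    b = e (f (inject₁ (fromℕ k))) x
    c = e (f (suc (fromℕ k))) x
    compose : ∀ t s a b c → (t * b - c) + t * (s * a - b) ≡ t * s * a - c
    compose = solve-∀

mainTheorem15 : (n m : ℕ) → (p : suc (suc n) ≤ m) → (θ : Fin (suc n) → Sign) →
    LinIndep (ℓ p θ)
    × Σ (Σ (Fin (suc n) → Sign) (λ δ → lincomb (λ i → sgn (δ i)) (ℓ p θ) ≗v target p θ))
        (λ D → (∀ (δ' : Fin (suc n) → Sign) → lincomb (λ i → sgn (δ' i)) (ℓ p θ) ≗v target p θ
                   → ∀ i → δ' i ≡ proj₁ D i)
               × (proj₁ D (fromℕ n) ≡ Sign.+)
               × (∀ (j : Fin n) →
                    (θ (suc j) ≡ Sign.+ → proj₁ D (inject₁ j) ≡ proj₁ D (suc j))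
                    × (θ (suc j) ≡ Sign.- → proj₁ D (inject₁ j) ≡ Sign.opposite (proj₁ D (suc j))))
               × (proj₁ D zero ≡ prodSign θ Sign.* θ zero))
    × (prodG (λ i → ℓ p θ i , θ i) ≈G (target p θ , prodSign θ))
mainTheorem15 n m p θ =
    independent
  , ( (δ , lincomb-δ) , unique , prodSignAfter-last θ , recurrence , prodSignAfter-zero θ )
  , prodG-ℓ′ (ι p) θ
  where
  δ : Fin (suc n) → Sign
  δ = prodSignAfter θ
  independent : LinIndep (ℓ p θ)
  independent = ℓ′-linIndep (ι p) θ (inject≤-injective p p _ _)
  lincomb-δ : lincomb (sgn ∘ δ) (ℓ p θ) ≗v target p θ
  lincomb-δ = lincomb-prodSignAfter-ℓ′ (ι p) θ
  unique : ∀ δ′ → lincomb (sgn ∘ δ′) (ℓ p θ) ≗v target p θ → ∀ i → δ′ i ≡ δ i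
  unique δ′ hδ′ i = ℤ.sign-cong (LinIndep⇒lincomb-injective {v = ℓ p θ} independent
    (sgn ∘ δ′) (sgn ∘ δ) (λ x → trans (hδ′ x) (sym (lincomb-δ x))) i)
  -- Sign.+ * s and Sign.- * s compute to s and Sign.opposite s.
  recurrence : ∀ j → (θ (suc j) ≡ Sign.+ → δ (inject₁ j) ≡ δ (suc j))
                   × (θ (suc j) ≡ Sign.- → δ (inject₁ j) ≡ Sign.opposite (δ (suc j)))
  recurrence j = step , step
    where
    step : ∀ {σ} → θ (suc j) ≡ σ → δ (inject₁ j) ≡ σ Sign.* δ (suc j)
    step θ≡σ = trans (prodSignAfter-inject₁ θ j) (cong (Sign._* δ (suc j)) θ≡σ)
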